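{- For $M,N\in\Lambda$, if $M=_{\mathsf v}N$ then $\mathrm{BT}(M)=\mathrm{BT}(N)$.
   Context: Call-by-value $\lambda$-calculus: $\Lambda$ is the set of $\lambda$-terms $M::=x\mid\lambda x.M\mid MN$ up to $\alpha$-conversion; values are variables and abstractions. Reductions: $(\beta_v)$ $(\lambda x.M)V\to M\{V/x\}$ for $V$ a value; $(\sigma_1)$ $(\lambda x.M)NP\to(\lambda x.MP)N$ if $x\notin FV(P)$; $(\sigma_3)$ $V((\lambda x.M)N)\to(\lambda x.VM)N$ if $V$ value, $x\notin FV(V)$. $\to_{\mathsf v}$ is the contextual closure of their union, $\twoheadrightarrow_{\mathsf v}$ its reflexive-transitive closure, $=_{\mathsf v}$ its reflexive-symmetric-transitive closure. $\Lambda_\bot$: $\lambda$-terms possibly containing $\bot$; $\sqsubseteq$ is the context-closed preorder generated by $\bot\sqsubseteq x$, $\bot\sqsubseteq\lambda x.M$. Approximants $\mathcal A$: $A::=B\mid C$; $B::=x\mid\lambda x.A\mid\bot\mid xBA_1\cdots A_k$; $C::=(\lambda x.A)(yBA_1\cdots A_k)$ ($k\ge0$). $\mathcal A(M)=\{A\in\mathcal A\mid\exists N,\ M\twoheadrightarrow_{\mathsf v}N,\ A\sqsubseteq N\}$; $\mathrm{BT}(M)=\bigsqcup\mathcal A(M)$ (with $\bigsqcup\emptyset=\emptyset$); $\mathrm{BT}(M)=\mathrm{BT}(N)$ iff $\mathcal A(M)=\mathcal A(N)$. -}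

module Defs where

open import Data.Nat using (ℕ; zero; suc)
open import Data.Product using (Σ; _×_; ∃; ∃-syntax)
open import Function.Bundles using (_⇔_)
open import Relation.Binary.Construct.Closure.ReflexiveTransitive using (Star)
open import Relation.Binary.Construct.Closure.Equivalence using (EqClosure)

-- λ-terms up to α-conversion: de Bruijn indices (free variables are
-- indices beyond the enclosing binders).
data Λ : Set where
  var : ℕ → Λ
  lam : Λ → Λ
  app : Λ → Λ → Λ

data Value : Λ → Set where
  var-val : ∀ x → Value (var x)
  lam-val : ∀ M → Value (lam M)

ext : (ℕ → ℕ) → ℕ → ℕ
ext ρ zero    = zero
ext ρ (suc n) = suc (ρ n)

rename : (ℕ → ℕ) → Λ → Λ
rename ρ (var x)   = var (ρ x)
rename ρ (lam M)   = lam (rename (ext ρ) M)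
rename ρ (app M N) = app (rename ρ M) (rename ρ N)

↑ : Λ → Λ
↑ = rename suc

exts : (ℕ → Λ) → ℕ → Λ
exts σ zero    = var zero
exts σ (suc n) = ↑ (σ n)

subst : (ℕ → Λ) → Λ → Λ
subst σ (var x)   = σ x
subst σ (lam M)   = lam (subst (exts σ) M)
subst σ (app M N) = app (subst σ M) (subst σ N)

-- M{V/x} where x is the variable bound by the enclosing λ (index 0)
single : Λ → ℕ → Λ
single V zero    = V
single V (suc n) = var n

_[_] : Λ → Λ → Λ
M [ V ] = subst (single V) M

-- root reductions βv, σ1, σ3 (side conditions x ∉ FV(..) are built in by weakening ↑)
data _↦_ : Λ → Λ → Set where
  βv : ∀ {M V} → Value V → app (lam M) V ↦ (M [ V ])
  σ1 : ∀ {M N P} → app (app (lam M) N) P ↦ app (lam (app M (↑ P))) N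
  σ3 : ∀ {V M N} → Value V → app V (app (lam M) N) ↦ app (lam (app (↑ V) M)) N

data _→v_ : Λ → Λ → Set where
  root  : ∀ {M N} → M ↦ N → M →v N
  ξ-lam : ∀ {M N} → M →v N → lam M →v lam N
  ξ-l   : ∀ {M N P} → M →v N → app M P →v app N P
  ξ-r   : ∀ {M N P} → M →v N → app P M →v app P N

_↠v_ : Λ → Λ → Set
_↠v_ = Star _→v_

_=v_ : Λ → Λ → Set
_=v_ = EqClosure _→v_

data Λ⊥ : Set where
  var : ℕ → Λ⊥
  lam : Λ⊥ → Λ⊥
  app : Λ⊥ → Λ⊥ → Λ⊥
  bot : Λ⊥

⌜_⌝ : Λ → Λ⊥
⌜ var x ⌝   = var x
⌜ lam M ⌝   = lam ⌜ M ⌝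
⌜ app M N ⌝ = app ⌜ M ⌝ ⌜ N ⌝

data _⊑_ : Λ⊥ → Λ⊥ → Set where
  ⊑-bot-var : ∀ {x} → bot ⊑ var x
  ⊑-bot-lam : ∀ {M} → bot ⊑ lam M
  ⊑-refl    : ∀ {M} → M ⊑ M
  ⊑-trans   : ∀ {M N P} → M ⊑ N → N ⊑ P → M ⊑ P
  ⊑-lam     : ∀ {M N} → M ⊑ N → lam M ⊑ lam N
  ⊑-app     : ∀ {M M′ N N′} → M ⊑ M′ → N ⊑ N′ → app M N ⊑ app M′ N′

-- approximants
--   A ::= B | C
--   B ::= x | λx.A | ⊥ | x B A₁ ⋯ A_k
--   C ::= (λx.A)(y B A₁ ⋯ A_k)          (k ≥ 0)
-- IsNeu t  means  t = y B A₁ ⋯ A_k  for some variable y, B ∈ B, A_i ∈ A.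
data IsA   : Λ⊥ → Set
data IsB   : Λ⊥ → Set
data IsC   : Λ⊥ → Set
data IsNeu : Λ⊥ → Set

data IsA where
  A-B : ∀ {t} → IsB t → IsA t
  A-C : ∀ {t} → IsC t → IsA t

data IsB where
  B-var : ∀ x → IsB (var x)
  B-lam : ∀ {A} → IsA A → IsB (lam A)
  B-bot : IsB bot
  B-neu : ∀ {t} → IsNeu t → IsB t

data IsC where
  C-red : ∀ {A t} → IsA A → IsNeu t → IsC (app (lam A) t)

data IsNeu where
  neu-base : ∀ y {B} → IsB B → IsNeu (app (var y) B)
  neu-app  : ∀ {t A} → IsNeu t → IsA A → IsNeu (app t A)

_∈𝒜_ : Λ⊥ → Λ → Set
A ∈𝒜 M = IsA A × ∃[ N ] (M ↠v N × A ⊑ ⌜ N ⌝)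

-- BT(M) = BT(N)  iff  𝒜(M) = 𝒜(N)
_≡BT_ : Λ → Λ → Set
M ≡BT N = ∀ A → (A ∈𝒜 M) ⇔ (A ∈𝒜 N)

-- Every →v-step is a parallel βv-step or a σ-step. Parallel βv-reduction has Takahashi's
-- triangle property w.r.t. complete development; σ-reduction is strongly normalising (a
-- weighted size decreases) and locally confluent, hence confluent by Newman's lemma; and
-- σ-steps commute with parallel βv-steps. So "⇛ followed by ↠σ" has the diamond property
-- and →v is confluent. An approximant A ⊑ M overlaps no redex of M: its applied
-- abstractions have neutral arguments, which are neither values nor of σ-redex shape, so
-- every redex of M lies under a ⊥ of A. Hence reduction preserves A ⊑ M, and together
-- with confluence this makes 𝒜 invariant under =v.

module Submission where

open import Defs
open import Data.Nat using (ℕ; zero; suc; _+_; _*_; _≤_; _<_; s≤s; z≤n)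
open import Data.Nat.Properties
open import Data.Nat.Induction using (<-wellFounded)
open import Data.Nat.Tactic.RingSolver using (solve-∀)
open import Data.Product using (∃-syntax; _×_; _,_; -,_)
open import Data.Sum using (_⊎_; inj₁; inj₂)
open import Data.Empty using (⊥-elim)
open import Relation.Nullary using (¬_)
open import Function.Base using (_∘_)
open import Function.Bundles using (mk⇔)
open import Function.Properties.Equivalence using (⇔-isEquivalence)
open import Induction.WellFounded using (module Subrelation)
open import Relation.Binary.Structures using (IsEquivalence)
open import Relation.Binary.Construct.On using () renaming (wellFounded to on-wellFounded)
open import Relation.Binary.Construct.Closure.ReflexiveTransitive using (Star; ε; _◅_; _◅◅_; gmap; _⋆)
open import Relation.Binary.Construct.Closure.ReflexiveTransitive as Star using ()
open import Relation.Binary.Construct.Closure.Transitive as Plus using (Plus; _∼⁺⟨_⟩_)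
open import Relation.Binary.Construct.Closure.Equivalence using (fold)
open import Relation.Binary.Rewriting using (Confluent; WeaklyConfluent; StronglyNormalizing; sn&wcr⇒cr)
open import Relation.Binary.PropositionalEquality using (_≡_; refl; sym; trans; cong; cong₂)
import Relation.Binary.PropositionalEquality as ≡

-- Abstract rewriting

Diamond : ∀ {A : Set} → (A → A → Set) → Set
Diamond {A} _⟶_ = ∀ {a b c : A} → a ⟶ b → a ⟶ c → ∃[ d ] (b ⟶ d × c ⟶ d)

module _ {A : Set} {_⟶_ : A → A → Set} (◇ : Diamond _⟶_) where

  diamond⇒strip : ∀ {a b c} → a ⟶ b → Star _⟶_ a c → ∃[ d ] (Star _⟶_ b d × c ⟶ d)
  diamond⇒strip r ε        = -, ε , r
  diamond⇒strip r (s ◅ ss) with ◇ r s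
  ... | _ , r′ , s′ with diamond⇒strip s′ ss
  ...   | d , ss′ , r″ = d , r′ ◅ ss′ , r″

  diamond⇒confluent : Confluent _⟶_
  diamond⇒confluent ε        ss = -, ss , ε
  diamond⇒confluent (r ◅ rs) ss with diamond⇒strip r ss
  ... | _ , ss′ , r′ with diamond⇒confluent rs ss′
  ...   | d , rs″ , ss″ = d , rs″ , r′ ◅ ss″

-- Substitution

ext-cong : ∀ {ρ ρ′ : ℕ → ℕ} → (∀ x → ρ x ≡ ρ′ x) → ∀ x → ext ρ x ≡ ext ρ′ x
ext-cong h zero    = refl
ext-cong h (suc x) = cong suc (h x)

rename-cong : ∀ {ρ ρ′ : ℕ → ℕ} → (∀ x → ρ x ≡ ρ′ x) → ∀ M → rename ρ M ≡ rename ρ′ M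
rename-cong h (var x)   = cong var (h x)
rename-cong h (lam M)   = cong lam (rename-cong (ext-cong h) M)
rename-cong h (app M N) = cong₂ app (rename-cong h M) (rename-cong h N)

exts-cong : ∀ {σ τ : ℕ → Λ} → (∀ x → σ x ≡ τ x) → ∀ x → exts σ x ≡ exts τ x
exts-cong h zero    = refl
exts-cong h (suc x) = cong ↑ (h x)

subst-cong : ∀ {σ τ : ℕ → Λ} → (∀ x → σ x ≡ τ x) → ∀ M → subst σ M ≡ subst τ M
subst-cong h (var x)   = h x
subst-cong h (lam M)   = cong lam (subst-cong (exts-cong h) M)
subst-cong h (app M N) = cong₂ app (subst-cong h M) (subst-cong h N)

rename-rename : ∀ ρ ρ′ M → rename ρ (rename ρ′ M) ≡ rename (ρ ∘ ρ′) M
rename-rename ρ ρ′ (var x)   = refl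
rename-rename ρ ρ′ (lam M)   =
  cong lam (trans (rename-rename (ext ρ) (ext ρ′) M) (rename-cong (λ { zero → refl ; (suc x) → refl }) M))
rename-rename ρ ρ′ (app M N) = cong₂ app (rename-rename ρ ρ′ M) (rename-rename ρ ρ′ N)

subst-rename : ∀ σ ρ M → subst σ (rename ρ M) ≡ subst (σ ∘ ρ) M
subst-rename σ ρ (var x)   = refl
subst-rename σ ρ (lam M)   =
  cong lam (trans (subst-rename (exts σ) (ext ρ) M) (subst-cong (λ { zero → refl ; (suc x) → refl }) M))
subst-rename σ ρ (app M N) = cong₂ app (subst-rename σ ρ M) (subst-rename σ ρ N)

rename-subst : ∀ ρ σ M → rename ρ (subst σ M) ≡ subst (rename ρ ∘ σ) M
rename-subst ρ σ (var x)   = refl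
rename-subst ρ σ (lam M)   = cong lam (trans (rename-subst (ext ρ) (exts σ) M) (subst-cong exts-ext M))
  where
  exts-ext : ∀ x → rename (ext ρ) (exts σ x) ≡ exts (rename ρ ∘ σ) x
  exts-ext zero    = refl
  exts-ext (suc x) = trans (rename-rename (ext ρ) suc (σ x)) (sym (rename-rename suc ρ (σ x)))
rename-subst ρ σ (app M N) = cong₂ app (rename-subst ρ σ M) (rename-subst ρ σ N)

subst-subst : ∀ σ τ M → subst σ (subst τ M) ≡ subst (subst σ ∘ τ) M
subst-subst σ τ (var x)   = refl
subst-subst σ τ (lam M)   = cong lam (trans (subst-subst (exts σ) (exts τ) M) (subst-cong exts-exts M))
  where
  exts-exts : ∀ x → subst (exts σ) (exts τ x) ≡ exts (subst σ ∘ τ) x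
  exts-exts zero    = refl
  exts-exts (suc x) = trans (subst-rename (exts σ) suc (τ x)) (sym (rename-subst suc σ (τ x)))
subst-subst σ τ (app M N) = cong₂ app (subst-subst σ τ M) (subst-subst σ τ N)

subst-var : ∀ M → subst var M ≡ M
subst-var (var x)   = refl
subst-var (lam M)   = cong lam (trans (subst-cong (λ { zero → refl ; (suc x) → refl }) M) (subst-var M))
subst-var (app M N) = cong₂ app (subst-var M) (subst-var N)

rename-as-subst : ∀ ρ M → rename ρ M ≡ subst (var ∘ ρ) M
rename-as-subst ρ M = trans (sym (subst-var (rename ρ M))) (subst-rename var ρ M)

↑-[] : ∀ P V → ↑ P [ V ] ≡ P
↑-[] P V = trans (subst-rename (single V) suc P) (subst-var P)

subst-exts-↑ : ∀ σ P → subst (exts σ) (↑ P) ≡ ↑ (subst σ P)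
subst-exts-↑ σ P = trans (subst-rename (exts σ) suc P) (sym (rename-subst suc σ P))

rename-ext-↑ : ∀ ρ P → rename (ext ρ) (↑ P) ≡ ↑ (rename ρ P)
rename-ext-↑ ρ P = trans (rename-rename (ext ρ) suc P) (sym (rename-rename suc ρ P))

subst-[] : ∀ σ M V → subst σ (M [ V ]) ≡ subst (exts σ) M [ subst σ V ]
subst-[] σ M V = begin
  subst σ (M [ V ])                         ≡⟨ subst-subst σ (single V) M ⟩
  subst (subst σ ∘ single V) M
    ≡⟨ subst-cong (λ { zero → refl ; (suc x) → sym (↑-[] (σ x) _) }) M ⟩
  subst (subst (single _) ∘ exts σ) M       ≡⟨ subst-subst (single (subst σ V)) (exts σ) M ⟨
  subst (exts σ) M [ subst σ V ]            ∎
  where open ≡.≡-Reasoning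

rename-[] : ∀ ρ M V → rename ρ (M [ V ]) ≡ rename (ext ρ) M [ rename ρ V ]
rename-[] ρ M V = begin
  rename ρ (M [ V ])                        ≡⟨ rename-as-subst ρ (M [ V ]) ⟩
  subst (var ∘ ρ) (M [ V ])                 ≡⟨ subst-[] (var ∘ ρ) M V ⟩
  subst (exts (var ∘ ρ)) M [ subst (var ∘ ρ) V ]
    ≡⟨ cong₂ _[_] (subst-cong (λ { zero → refl ; (suc x) → refl }) M) (rename-as-subst ρ V) ⟨
  subst (var ∘ ext ρ) M [ rename ρ V ]      ≡⟨ cong (_[ rename ρ V ]) (rename-as-subst (ext ρ) M) ⟨
  rename (ext ρ) M [ rename ρ V ]           ∎
  where open ≡.≡-Reasoning

ValueSubst : (ℕ → Λ) → Set
ValueSubst σ = ∀ x → Value (σ x)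

rename-Value : ∀ ρ {V} → Value V → Value (rename ρ V)
rename-Value ρ (var-val x) = var-val _
rename-Value ρ (lam-val M) = lam-val _

subst-Value : ∀ {σ} → ValueSubst σ → ∀ {V} → Value V → Value (subst σ V)
subst-Value vσ (var-val x) = vσ x
subst-Value vσ (lam-val M) = lam-val _

exts-ValueSubst : ∀ {σ} → ValueSubst σ → ValueSubst (exts σ)
exts-ValueSubst vσ zero    = var-val zero
exts-ValueSubst vσ (suc x) = rename-Value suc (vσ x)

single-ValueSubst : ∀ {V} → Value V → ValueSubst (single V)
single-ValueSubst v zero    = v
single-ValueSubst v (suc x) = var-val x

-- Parallel βv-reduction and complete development

infix 4 _⇛_

data _⇛_ : Λ → Λ → Set where
  ⇛-var : ∀ {x} → var x ⇛ var x
  ⇛-lam : ∀ {M M′} → M ⇛ M′ → lam M ⇛ lam M′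
  ⇛-app : ∀ {M M′ N N′} → M ⇛ M′ → N ⇛ N′ → app M N ⇛ app M′ N′
  ⇛-βv  : ∀ {M M′ V V′} → M ⇛ M′ → V ⇛ V′ → Value V → app (lam M) V ⇛ M′ [ V′ ]

⇛-refl : ∀ M → M ⇛ M
⇛-refl (var x)   = ⇛-var
⇛-refl (lam M)   = ⇛-lam (⇛-refl M)
⇛-refl (app M N) = ⇛-app (⇛-refl M) (⇛-refl N)

⇛-Value : ∀ {V V′} → V ⇛ V′ → Value V → Value V′
⇛-Value ⇛-var     (var-val x) = var-val _
⇛-Value (⇛-lam p) (lam-val M) = lam-val _

⇛-rename : ∀ ρ {M M′} → M ⇛ M′ → rename ρ M ⇛ rename ρ M′
⇛-rename ρ ⇛-var       = ⇛-var
⇛-rename ρ (⇛-lam p)   = ⇛-lam (⇛-rename (ext ρ) p)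
⇛-rename ρ (⇛-app p q) = ⇛-app (⇛-rename ρ p) (⇛-rename ρ q)
⇛-rename ρ (⇛-βv {M′ = M′} {V′ = V′} p q v) =
  ≡.respʳ _⇛_ (sym (rename-[] ρ M′ V′))
    (⇛-βv (⇛-rename (ext ρ) p) (⇛-rename ρ q) (rename-Value ρ v))

⇛-exts : ∀ {σ τ} → (∀ x → σ x ⇛ τ x) → ∀ x → exts σ x ⇛ exts τ x
⇛-exts σ⇛τ zero    = ⇛-var
⇛-exts σ⇛τ (suc x) = ⇛-rename suc (σ⇛τ x)

⇛-subst : ∀ {σ τ} → (∀ x → σ x ⇛ τ x) → ValueSubst σ →
          ∀ {M M′} → M ⇛ M′ → subst σ M ⇛ subst τ M′
⇛-subst σ⇛τ vσ (⇛-var {x}) = σ⇛τ x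
⇛-subst σ⇛τ vσ (⇛-lam p)   = ⇛-lam (⇛-subst (⇛-exts σ⇛τ) (exts-ValueSubst vσ) p)
⇛-subst σ⇛τ vσ (⇛-app p q) = ⇛-app (⇛-subst σ⇛τ vσ p) (⇛-subst σ⇛τ vσ q)
⇛-subst {τ = τ} σ⇛τ vσ (⇛-βv {M′ = M′} {V′ = V′} p q v) =
  ≡.respʳ _⇛_ (sym (subst-[] τ M′ V′))
    (⇛-βv (⇛-subst (⇛-exts σ⇛τ) (exts-ValueSubst vσ) p) (⇛-subst σ⇛τ vσ q) (subst-Value vσ v))

⇛-[] : ∀ {M M′ V V′} → M ⇛ M′ → V ⇛ V′ → Value V → M [ V ] ⇛ M′ [ V′ ]
⇛-[] p q v = ⇛-subst (λ { zero → q ; (suc x) → ⇛-var }) (single-ValueSubst v) p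

develop : Λ → Λ
develop (var x)                 = var x
develop (lam M)                 = lam (develop M)
develop (app (lam M) (var x))   = develop M [ var x ]
develop (app (lam M) (lam N))   = develop M [ lam (develop N) ]
develop (app (lam M) (app N P)) = app (lam (develop M)) (develop (app N P))
develop (app (var x) N)         = app (var x) (develop N)
develop (app (app M P) N)       = app (develop (app M P)) (develop N)

⇛-develop : ∀ {M N} → M ⇛ N → N ⇛ develop M
⇛-develop ⇛-var     = ⇛-var
⇛-develop (⇛-lam p) = ⇛-lam (⇛-develop p)
⇛-develop (⇛-app {M = lam M} {N = var x} (⇛-lam p) q) =
  ⇛-βv (⇛-develop p) (⇛-develop q) (⇛-Value q (var-val x))
⇛-develop (⇛-app {M = lam M} {N = lam N} (⇛-lam p) q) =
  ⇛-βv (⇛-develop p) (⇛-develop q) (⇛-Value q (lam-val N))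
⇛-develop (⇛-app {M = lam M} {N = app N P} p q) = ⇛-app (⇛-develop p) (⇛-develop q)
⇛-develop (⇛-app {M = var x} p q)               = ⇛-app (⇛-develop p) (⇛-develop q)
⇛-develop (⇛-app {M = app M P} p q)             = ⇛-app (⇛-develop p) (⇛-develop q)
⇛-develop (⇛-βv {V = var x} p q v) = ⇛-[] (⇛-develop p) (⇛-develop q) (⇛-Value q v)
⇛-develop (⇛-βv {V = lam V} p q v) = ⇛-[] (⇛-develop p) (⇛-develop q) (⇛-Value q v)

-- σ-reduction: strong normalisation and confluence

infix 4 _→σ_ _↠σ_

data _→σ_ : Λ → Λ → Set where
  σ₁    : ∀ {M N P} → app (app (lam M) N) P →σ app (lam (app M (↑ P))) N
  σ₃    : ∀ {V M N} → Value V → app V (app (lam M) N) →σ app (lam (app (↑ V) M)) N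
  ξ-lam : ∀ {M M′} → M →σ M′ → lam M →σ lam M′
  ξ-l   : ∀ {M M′ P} → M →σ M′ → app M P →σ app M′ P
  ξ-r   : ∀ {M M′ P} → M →σ M′ → app P M →σ app P M′

_↠σ_ : Λ → Λ → Set
_↠σ_ = Star _→σ_

→σ-Value : ∀ {V V′} → Value V → V →σ V′ → Value V′
→σ-Value (lam-val M) (ξ-lam p) = lam-val _

→σ-subst : ∀ {σ} → ValueSubst σ → ∀ {M N} → M →σ N → subst σ M →σ subst σ N
→σ-subst {σ} vσ (σ₁ {P = P}) =
  ≡.respʳ _→σ_ (cong (λ P′ → app (lam (app _ P′)) _) (sym (subst-exts-↑ σ P))) σ₁
→σ-subst {σ} vσ (σ₃ {V} v) =
  ≡.respʳ _→σ_ (cong (λ V′ → app (lam (app V′ _)) _) (sym (subst-exts-↑ σ V)))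
    (σ₃ (subst-Value vσ v))
→σ-subst vσ (ξ-lam p) = ξ-lam (→σ-subst (exts-ValueSubst vσ) p)
→σ-subst vσ (ξ-l p)   = ξ-l (→σ-subst vσ p)
→σ-subst vσ (ξ-r p)   = ξ-r (→σ-subst vσ p)

→σ-rename : ∀ ρ {M N} → M →σ N → rename ρ M →σ rename ρ N
→σ-rename ρ {M} {N} p =
  ≡.subst₂ _→σ_ (sym (rename-as-subst ρ M)) (sym (rename-as-subst ρ N))
    (→σ-subst (λ x → var-val _) p)

↠σ-lam : ∀ {M N} → M ↠σ N → lam M ↠σ lam N
↠σ-lam = gmap lam ξ-lam

↠σ-app : ∀ {M M′ N N′} → M ↠σ M′ → N ↠σ N′ → app M N ↠σ app M′ N′
↠σ-app p q = gmap _ ξ-l p ◅◅ gmap _ ξ-r q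

subst-↠σ : ∀ {σ τ} → (∀ x → σ x ↠σ τ x) → ∀ M → subst σ M ↠σ subst τ M
subst-↠σ σ↠τ (var x)   = σ↠τ x
subst-↠σ σ↠τ (lam M)   = ↠σ-lam (subst-↠σ exts-↠σ M)
  where
  exts-↠σ : ∀ x → exts _ x ↠σ exts _ x
  exts-↠σ zero    = ε
  exts-↠σ (suc x) = gmap ↑ (→σ-rename suc) (σ↠τ x)
subst-↠σ σ↠τ (app M N) = ↠σ-app (subst-↠σ σ↠τ M) (subst-↠σ σ↠τ N)

[]-↠σ : ∀ M {V V′} → V ↠σ V′ → M [ V ] ↠σ M [ V′ ]
[]-↠σ M V↠V′ = subst-↠σ (λ { zero → V↠V′ ; (suc x) → ε }) M

-- Both σ-rules replace an application whose head is an application or a value by one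
-- whose head is an abstraction; weighing abstraction heads 1 instead of 2 makes size drop.
headWeight : Λ → ℕ
headWeight (lam _)   = 1
headWeight (var _)   = 2
headWeight (app _ _) = 2

size : Λ → ℕ
size (var x)   = 1
size (lam M)   = size M
size (app M N) = headWeight M * size M + 2 * size N

headWeight-rename : ∀ ρ M → headWeight (rename ρ M) ≡ headWeight M
headWeight-rename ρ (var x)   = refl
headWeight-rename ρ (lam M)   = refl
headWeight-rename ρ (app M N) = refl

size-rename : ∀ ρ M → size (rename ρ M) ≡ size M
size-rename ρ (var x)   = refl
size-rename ρ (lam M)   = size-rename (ext ρ) M
size-rename ρ (app M N) =
  cong₂ _+_ (cong₂ _*_ (headWeight-rename ρ M) (size-rename ρ M)) (cong (2 *_) (size-rename ρ N))

headWeight-→σ : ∀ {M N} → M →σ N → headWeight M ≡ headWeight N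
headWeight-→σ σ₁        = refl
headWeight-→σ (σ₃ v)    = refl
headWeight-→σ (ξ-lam p) = refl
headWeight-→σ (ξ-l p)   = refl
headWeight-→σ (ξ-r p)   = refl

headWeight≤2 : ∀ M → headWeight M ≤ 2
headWeight≤2 (var x)   = ≤-refl
headWeight≤2 (lam M)   = s≤s z≤n
headWeight≤2 (app M N) = ≤-refl

headWeight-*-monoʳ-< : ∀ M {m n} → m < n → headWeight M * m < headWeight M * n
headWeight-*-monoʳ-< (var x)   = *-monoʳ-< 2
headWeight-*-monoʳ-< (lam M)   = *-monoʳ-< 1
headWeight-*-monoʳ-< (app M N) = *-monoʳ-< 2

0<2*size : ∀ M → 0 < 2 * size M
0<2*size (var x)   = s≤s z≤n
0<2*size (lam M)   = 0<2*size M
0<2*size (app M N) = ≤-trans (0<2*size N) (≤-trans (m≤n+m _ (headWeight M * size M)) (m≤n*m _ 2))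

size-→σ : ∀ {M N} → M →σ N → size N < size M
size-→σ (σ₁ {M} {N} {P}) rewrite size-rename suc P = begin-strict
  1 * (headWeight M * size M + 2 * size P) + 2 * size N
    ≤⟨ +-monoˡ-≤ (2 * size N)
         (*-monoʳ-≤ 1 (+-monoˡ-≤ (2 * size P) (*-monoˡ-≤ (size M) (headWeight≤2 M)))) ⟩
  1 * (2 * size M + 2 * size P) + 2 * size N
    <⟨ m<m+n _ (0<2*size N) ⟩
  1 * (2 * size M + 2 * size P) + 2 * size N + 2 * size N
    ≡⟨ rearrange (size M) (size N) (size P) ⟩
  2 * (1 * size M + 2 * size N) + 2 * size P ∎
  where
  open ≤-Reasoning
  rearrange : ∀ m n p → 1 * (2 * m + 2 * p) + 2 * n + 2 * n ≡ 2 * (1 * m + 2 * n) + 2 * p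
  rearrange = solve-∀
size-→σ (σ₃ {V} {M} {N} v) rewrite size-rename suc V | headWeight-rename suc V = begin-strict
  1 * (headWeight V * size V + 2 * size M) + 2 * size N
    <⟨ m<m+n _ (0<2*size N) ⟩
  1 * (headWeight V * size V + 2 * size M) + 2 * size N + 2 * size N
    ≡⟨ rearrange (headWeight V * size V) (size M) (size N) ⟩
  headWeight V * size V + 2 * (1 * size M + 2 * size N) ∎
  where
  open ≤-Reasoning
  rearrange : ∀ a m n → 1 * (a + 2 * m) + 2 * n + 2 * n ≡ a + 2 * (1 * m + 2 * n)
  rearrange = solve-∀
size-→σ (ξ-lam p) = size-→σ p
size-→σ (ξ-l {M′ = M′} {P = P} p) rewrite headWeight-→σ p =
  +-monoˡ-< (2 * size P) (headWeight-*-monoʳ-< M′ (size-→σ p))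
size-→σ (ξ-r {P = P} p) = +-monoʳ-< (headWeight P * size P) (*-monoʳ-< 2 (size-→σ p))

size-→σ⁺ : ∀ {M N} → Plus _→σ_ M N → size N < size M
size-→σ⁺ Plus.[ p ]        = size-→σ p
size-→σ⁺ (_ ∼⁺⟨ p ⟩ q) = <-trans (size-→σ⁺ q) (size-→σ⁺ p)

→σ-stronglyNormalizing : StronglyNormalizing (Plus _→σ_)
→σ-stronglyNormalizing = Subrelation.wellFounded size-→σ⁺ (on-wellFounded size <-wellFounded)

Joinable : Λ → Λ → Set
Joinable M N = ∃[ Q ] (M ↠σ Q × N ↠σ Q)

Joinable-sym : ∀ {M N} → Joinable M N → Joinable N M
Joinable-sym (Q , p , q) = Q , q , p

Joinable-map : ∀ (f : Λ → Λ) → (∀ {M N} → M ↠σ N → f M ↠σ f N) →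
               ∀ {M N} → Joinable M N → Joinable (f M) (f N)
Joinable-map f f-↠σ (Q , p , q) = f Q , f-↠σ p , f-↠σ q

σ₁-σ₃-joinable : ∀ M K L P →
  Joinable (app (lam (app M (↑ P))) (app (lam K) L)) (app (app (lam (app (↑ (lam M)) K)) L) P)
σ₁-σ₃-joinable M K L P =
  -, ≡.respʳ _→σ_ (cong (λ P′ → app (lam (app (lam (app _ P′)) K)) L) (rename-ext-↑ suc P))
       (σ₃ (lam-val _)) ◅ ε
   , σ₁ ◅ ξ-l (ξ-lam σ₁) ◅ ε

σ₃-σ₃-joinable : ∀ {V} M K L → Value V →
  Joinable (app (lam (app (↑ V) M)) (app (lam K) L)) (app V (app (lam (app (↑ (lam M)) K)) L))
σ₃-σ₃-joinable {V} M K L v =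
  -, ≡.respʳ _→σ_ (cong (λ V′ → app (lam (app (lam (app V′ _)) K)) L) (rename-ext-↑ suc V))
       (σ₃ (lam-val _)) ◅ ε
   , σ₃ v ◅ ξ-l (ξ-lam (σ₃ (rename-Value suc v))) ◅ ε

σ₁-joinable : ∀ {M N P Q} → app (app (lam M) N) P →σ Q →
              Joinable (app (lam (app M (↑ P))) N) Q
σ₁-joinable σ₁                    = -, ε , ε
σ₁-joinable {M} {P = P} (ξ-l (σ₃ {M = K} {N = L} v)) = σ₁-σ₃-joinable M K L P
σ₁-joinable (ξ-l (ξ-l (ξ-lam p))) = -, ξ-l (ξ-lam (ξ-l p)) ◅ ε , σ₁ ◅ ε
σ₁-joinable (ξ-l (ξ-r p))         = -, ξ-r p ◅ ε , σ₁ ◅ ε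
σ₁-joinable (ξ-r p)               = -, ξ-l (ξ-lam (ξ-r (→σ-rename suc p))) ◅ ε , σ₁ ◅ ε

σ₃-joinable : ∀ {V M N Q} → Value V → app V (app (lam M) N) →σ Q →
              Joinable (app (lam (app (↑ V) M)) N) Q
σ₃-joinable v (σ₃ _)                = -, ε , ε
σ₃-joinable v (ξ-l p)               = -, ξ-l (ξ-lam (ξ-l (→σ-rename suc p))) ◅ ε , σ₃ (→σ-Value v p) ◅ ε
σ₃-joinable {M = M} v (ξ-r (σ₃ {M = K} {N = L} _)) = σ₃-σ₃-joinable M K L v
σ₃-joinable v (ξ-r (ξ-l (ξ-lam p))) = -, ξ-l (ξ-lam (ξ-r p)) ◅ ε , σ₃ v ◅ ε
σ₃-joinable v (ξ-r (ξ-r p))         = -, ξ-r p ◅ ε , σ₃ v ◅ ε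

→σ-weaklyConfluent : WeaklyConfluent _→σ_
→σ-weaklyConfluent σ₁        q         = σ₁-joinable q
→σ-weaklyConfluent (σ₃ v)    q         = σ₃-joinable v q
→σ-weaklyConfluent (ξ-lam p) (ξ-lam q) = Joinable-map lam ↠σ-lam (→σ-weaklyConfluent p q)
→σ-weaklyConfluent (ξ-l p)   σ₁        = Joinable-sym (σ₁-joinable (ξ-l p))
→σ-weaklyConfluent (ξ-l p)   (σ₃ v)    = Joinable-sym (σ₃-joinable v (ξ-l p))
→σ-weaklyConfluent (ξ-l p)   (ξ-l q)   =
  Joinable-map (λ M → app M _) (λ r → ↠σ-app r ε) (→σ-weaklyConfluent p q)
→σ-weaklyConfluent (ξ-l p)   (ξ-r q)   = -, ξ-r q ◅ ε , ξ-l p ◅ ε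
→σ-weaklyConfluent (ξ-r p)   σ₁        = Joinable-sym (σ₁-joinable (ξ-r p))
→σ-weaklyConfluent (ξ-r p)   (σ₃ v)    = Joinable-sym (σ₃-joinable v (ξ-r p))
→σ-weaklyConfluent (ξ-r p)   (ξ-l q)   = -, ξ-l q ◅ ε , ξ-r p ◅ ε
→σ-weaklyConfluent (ξ-r p)   (ξ-r q)   = Joinable-map (app _) (↠σ-app ε) (→σ-weaklyConfluent p q)

↠σ-confluent : Confluent _→σ_
↠σ-confluent = sn&wcr⇒cr →σ-stronglyNormalizing →σ-weaklyConfluent

-- Confluence of →v

→σ-⇛-commute : ∀ {M N P} → M →σ N → M ⇛ P → ∃[ Q ] (N ⇛ Q × P ↠σ Q)
→σ-⇛-commute σ₁ (⇛-app (⇛-app (⇛-lam p) q) r) =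
  -, ⇛-app (⇛-lam (⇛-app p (⇛-rename suc r))) q , σ₁ ◅ ε
→σ-⇛-commute σ₁ (⇛-app (⇛-βv {M′ = M′} {V′ = V′} p q v) r) =
  -, ≡.respʳ _⇛_ (cong (app (M′ [ V′ ])) (↑-[] _ V′)) (⇛-βv (⇛-app p (⇛-rename suc r)) q v)
   , ε
→σ-⇛-commute (σ₃ v) (⇛-app p (⇛-app (⇛-lam q) r)) =
  -, ⇛-app (⇛-lam (⇛-app (⇛-rename suc p) q)) r , σ₃ (⇛-Value p v) ◅ ε
→σ-⇛-commute (σ₃ v) (⇛-app {M′ = V′} p (⇛-βv {V′ = W′} q r w)) =
  -, ≡.respʳ _⇛_ (cong (λ U → app U _) (↑-[] V′ W′)) (⇛-βv (⇛-app (⇛-rename suc p) q) r w)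
   , ε
→σ-⇛-commute (ξ-lam s) (⇛-lam p) with →σ-⇛-commute s p
... | _ , q , r = -, ⇛-lam q , ↠σ-lam r
→σ-⇛-commute (ξ-l s) (⇛-app p p′) with →σ-⇛-commute s p
... | _ , q , r = -, ⇛-app q p′ , ↠σ-app r ε
→σ-⇛-commute (ξ-l (ξ-lam s)) (⇛-βv p p′ v) with →σ-⇛-commute s p
... | _ , q , r = -, ⇛-βv q p′ v , gmap _ (→σ-subst (single-ValueSubst (⇛-Value p′ v))) r
→σ-⇛-commute (ξ-r s) (⇛-app p p′) with →σ-⇛-commute s p′
... | _ , q , r = -, ⇛-app p q , ↠σ-app ε r
→σ-⇛-commute (ξ-r s) (⇛-βv {M′ = M′} p p′ v) with →σ-⇛-commute s p′
... | _ , q , r = -, ⇛-βv p q (→σ-Value v s) , []-↠σ M′ r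

↠σ-⇛-commute : ∀ {M N P} → M ↠σ N → M ⇛ P → ∃[ Q ] (N ⇛ Q × P ↠σ Q)
↠σ-⇛-commute ε        p = -, p , ε
↠σ-⇛-commute (s ◅ ss) p with →σ-⇛-commute s p
... | _ , q , r with ↠σ-⇛-commute ss q
...   | Q , q′ , r′ = Q , q′ , r ◅◅ r′

infix 4 _⇛σ_

_⇛σ_ : Λ → Λ → Set
M ⇛σ N = ∃[ K ] (M ⇛ K × K ↠σ N)

-- Both sides commute their σ-steps past the development of M, then meet by σ-confluence.
⇛σ-diamond : Diamond _⇛σ_
⇛σ-diamond (_ , p , r) (_ , q , s)
  with ↠σ-⇛-commute r (⇛-develop p) | ↠σ-⇛-commute s (⇛-develop q)
... | D , p′ , r′ | E , q′ , s′ with ↠σ-confluent r′ s′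
...   | F , r″ , s″ = F , (D , p′ , r″) , (E , q′ , s″)

→v⇒⇛⊎→σ : ∀ {M N} → M →v N → M ⇛ N ⊎ M →σ N
→v⇒⇛⊎→σ (root (βv v)) = inj₁ (⇛-βv (⇛-refl _) (⇛-refl _) v)
→v⇒⇛⊎→σ (root σ1)     = inj₂ σ₁
→v⇒⇛⊎→σ (root (σ3 v)) = inj₂ (σ₃ v)
→v⇒⇛⊎→σ (ξ-lam s) with →v⇒⇛⊎→σ s
... | inj₁ p = inj₁ (⇛-lam p)
... | inj₂ r = inj₂ (ξ-lam r)
→v⇒⇛⊎→σ (ξ-l s) with →v⇒⇛⊎→σ s
... | inj₁ p = inj₁ (⇛-app p (⇛-refl _))
... | inj₂ r = inj₂ (ξ-l r)
→v⇒⇛⊎→σ (ξ-r s) with →v⇒⇛⊎→σ s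
... | inj₁ p = inj₁ (⇛-app (⇛-refl _) p)
... | inj₂ r = inj₂ (ξ-r r)

→v⇒⇛σ : ∀ {M N} → M →v N → M ⇛σ N
→v⇒⇛σ s with →v⇒⇛⊎→σ s
... | inj₁ p = -, p , ε
... | inj₂ r = -, ⇛-refl _ , r ◅ ε

→σ⇒→v : ∀ {M N} → M →σ N → M →v N
→σ⇒→v σ₁        = root σ1
→σ⇒→v (σ₃ v)    = root (σ3 v)
→σ⇒→v (ξ-lam r) = ξ-lam (→σ⇒→v r)
→σ⇒→v (ξ-l r)   = ξ-l (→σ⇒→v r)
→σ⇒→v (ξ-r r)   = ξ-r (→σ⇒→v r)

↠v-lam : ∀ {M N} → M ↠v N → lam M ↠v lam N
↠v-lam = gmap lam ξ-lam

↠v-app : ∀ {M M′ N N′} → M ↠v M′ → N ↠v N′ → app M N ↠v app M′ N′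
↠v-app p q = gmap _ ξ-l p ◅◅ gmap _ ξ-r q

⇛⇒↠v : ∀ {M N} → M ⇛ N → M ↠v N
⇛⇒↠v ⇛-var        = ε
⇛⇒↠v (⇛-lam p)    = ↠v-lam (⇛⇒↠v p)
⇛⇒↠v (⇛-app p q)  = ↠v-app (⇛⇒↠v p) (⇛⇒↠v q)
⇛⇒↠v (⇛-βv p q v) = ↠v-app (↠v-lam (⇛⇒↠v p)) (⇛⇒↠v q) ◅◅ root (βv (⇛-Value q v)) ◅ ε

⇛σ⇒↠v : ∀ {M N} → M ⇛σ N → M ↠v N
⇛σ⇒↠v (_ , p , r) = ⇛⇒↠v p ◅◅ gmap _ →σ⇒→v r

↠v-confluent : Confluent _→v_
↠v-confluent p q with diamond⇒confluent ⇛σ-diamond (Star.map →v⇒⇛σ p) (Star.map →v⇒⇛σ q)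
... | Q , p′ , q′ = Q , (⇛σ⇒↠v ⋆) p′ , (⇛σ⇒↠v ⋆) q′

-- Approximants

infix 4 _≼_

-- A syntax-directed form of A ⊑ ⌜ M ⌝ (no transitivity rule), so that proofs can split on M.
data _≼_ : Λ⊥ → Λ → Set where
  ≼-bot-var : ∀ {x} → bot ≼ var x
  ≼-bot-lam : ∀ {M} → bot ≼ lam M
  ≼-var     : ∀ {x} → var x ≼ var x
  ≼-lam     : ∀ {A M} → A ≼ M → lam A ≼ lam M
  ≼-app     : ∀ {A B M N} → A ≼ M → B ≼ N → app A B ≼ app M N

⌜⌝-≼ : ∀ M → ⌜ M ⌝ ≼ M
⌜⌝-≼ (var x)   = ≼-var
⌜⌝-≼ (lam M)   = ≼-lam (⌜⌝-≼ M)
⌜⌝-≼ (app M N) = ≼-app (⌜⌝-≼ M) (⌜⌝-≼ N)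

⊑-≼-trans : ∀ {A B M} → A ⊑ B → B ≼ M → A ≼ M
⊑-≼-trans ⊑-bot-var      ≼-var         = ≼-bot-var
⊑-≼-trans ⊑-bot-lam      (≼-lam _)     = ≼-bot-lam
⊑-≼-trans ⊑-refl         q             = q
⊑-≼-trans (⊑-trans p p′) q             = ⊑-≼-trans p (⊑-≼-trans p′ q)
⊑-≼-trans (⊑-lam p)      (≼-lam q)     = ≼-lam (⊑-≼-trans p q)
⊑-≼-trans (⊑-app p p′)   (≼-app q q′)  = ≼-app (⊑-≼-trans p q) (⊑-≼-trans p′ q′)

⊑⌜⌝⇒≼ : ∀ {A} M → A ⊑ ⌜ M ⌝ → A ≼ M
⊑⌜⌝⇒≼ M p = ⊑-≼-trans p (⌜⌝-≼ M)

≼⇒⊑⌜⌝ : ∀ {A M} → A ≼ M → A ⊑ ⌜ M ⌝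
≼⇒⊑⌜⌝ ≼-bot-var   = ⊑-bot-var
≼⇒⊑⌜⌝ ≼-bot-lam   = ⊑-bot-lam
≼⇒⊑⌜⌝ ≼-var       = ⊑-refl
≼⇒⊑⌜⌝ (≼-lam p)   = ⊑-lam (≼⇒⊑⌜⌝ p)
≼⇒⊑⌜⌝ (≼-app p q) = ⊑-app (≼⇒⊑⌜⌝ p) (≼⇒⊑⌜⌝ q)

IsNeu-≼-Value : ∀ {t V} → IsNeu t → t ≼ V → ¬ Value V
IsNeu-≼-Value (neu-base _ _) (≼-app _ _) ()
IsNeu-≼-Value (neu-app _ _)  (≼-app _ _) ()

IsNeu-≼-βredex : ∀ {t M N} → IsNeu t → ¬ (t ≼ app (lam M) N)
IsNeu-≼-βredex (neu-base y b) (≼-app () _)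
IsNeu-≼-βredex (neu-app n a)  (≼-app p _) = IsNeu-≼-Value n p (lam-val _)

IsB-≼-βredex : ∀ {B M N} → IsB B → ¬ (B ≼ app (lam M) N)
IsB-≼-βredex (B-neu n) = IsNeu-≼-βredex n

≼-stepᴬ   : ∀ {A M N} → IsA A   → A ≼ M → M →v N → A ≼ N
≼-stepᴮ   : ∀ {A M N} → IsB A   → A ≼ M → M →v N → A ≼ N
≼-stepᶜ   : ∀ {A M N} → IsC A   → A ≼ M → M →v N → A ≼ N
≼-stepᴺᵉᵘ : ∀ {A M N} → IsNeu A → A ≼ M → M →v N → A ≼ N

≼-stepᴬ (A-B b) = ≼-stepᴮ b
≼-stepᴬ (A-C c) = ≼-stepᶜ c

≼-stepᴮ (B-var x) ≼-var     (root ())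
≼-stepᴮ (B-lam a) (≼-lam p) (ξ-lam s) = ≼-lam (≼-stepᴬ a p s)
≼-stepᴮ B-bot     ≼-bot-var (root ())
≼-stepᴮ B-bot     ≼-bot-lam (ξ-lam s) = ≼-bot-lam
≼-stepᴮ (B-neu n) p         s         = ≼-stepᴺᵉᵘ n p s

≼-stepᶜ (C-red a n) (≼-app p q)         (root (βv v))   = ⊥-elim (IsNeu-≼-Value n q v)
≼-stepᶜ (C-red a n) (≼-app () q)        (root σ1)
≼-stepᶜ (C-red a n) (≼-app p q)         (root (σ3 v))   = ⊥-elim (IsNeu-≼-βredex n q)
≼-stepᶜ (C-red a n) (≼-app (≼-lam p) q) (ξ-l (ξ-lam s)) = ≼-app (≼-lam (≼-stepᴬ a p s)) q
≼-stepᶜ (C-red a n) (≼-app p q)         (ξ-r s)         = ≼-app p (≼-stepᴺᵉᵘ n q s)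

≼-stepᴺᵉᵘ (neu-base y b) (≼-app ≼-var q) (root (σ3 v)) = ⊥-elim (IsB-≼-βredex b q)
≼-stepᴺᵉᵘ (neu-base y b) (≼-app ≼-var q) (ξ-l (root ()))
≼-stepᴺᵉᵘ (neu-base y b) (≼-app ≼-var q) (ξ-r s)       = ≼-app ≼-var (≼-stepᴮ b q s)
≼-stepᴺᵉᵘ (neu-app n a)  (≼-app p q) (root (βv v))     = ⊥-elim (IsNeu-≼-Value n p (lam-val _))
≼-stepᴺᵉᵘ (neu-app n a)  (≼-app p q) (root σ1)         = ⊥-elim (IsNeu-≼-βredex n p)
≼-stepᴺᵉᵘ (neu-app n a)  (≼-app p q) (root (σ3 v))     = ⊥-elim (IsNeu-≼-Value n p v)
≼-stepᴺᵉᵘ (neu-app n a)  (≼-app p q) (ξ-l s)           = ≼-app (≼-stepᴺᵉᵘ n p s) q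
≼-stepᴺᵉᵘ (neu-app n a)  (≼-app p q) (ξ-r s)           = ≼-app p (≼-stepᴬ a q s)

≼-steps : ∀ {A M N} → IsA A → A ≼ M → M ↠v N → A ≼ N
≼-steps a p ε        = p
≼-steps a p (s ◅ ss) = ≼-steps a (≼-stepᴬ a p s) ss

∈𝒜-↠v : ∀ {A M N} → M ↠v N → A ∈𝒜 M → A ∈𝒜 N
∈𝒜-↠v M↠N (a , M′ , M↠M′ , A⊑M′) with ↠v-confluent M↠N M↠M′
... | P , N↠P , M′↠P = a , P , N↠P , ≼⇒⊑⌜⌝ (≼-steps a (⊑⌜⌝⇒≼ M′ A⊑M′) M′↠P)

∈𝒜-↞v : ∀ {A M N} → M ↠v N → A ∈𝒜 N → A ∈𝒜 M
∈𝒜-↞v M↠N (a , N′ , N↠N′ , A⊑N′) = a , N′ , M↠N ◅◅ N↠N′ , A⊑N′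

↠v⇒≡BT : ∀ {M N} → M ↠v N → M ≡BT N
↠v⇒≡BT M↠N A = mk⇔ (∈𝒜-↠v M↠N) (∈𝒜-↞v M↠N)

≡BT-isEquivalence : IsEquivalence _≡BT_
≡BT-isEquivalence = record
  { refl  = λ A → ⇔-refl
  ; sym   = λ M≡N A → ⇔-sym (M≡N A)
  ; trans = λ M≡N N≡P A → ⇔-trans (M≡N A) (N≡P A)
  }
  where
  open IsEquivalence ⇔-isEquivalence renaming (refl to ⇔-refl; sym to ⇔-sym; trans to ⇔-trans)

proposition2p11 : ∀ (M N : Λ) → M =v N → M ≡BT N
proposition2p11 M N = fold ≡BT-isEquivalence (λ s → ↠v⇒≡BT (s ◅ ε))
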